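{- For $m\ge2$, each of the three cyclic components $U_m$, $V_m$, $I_m$ of $\Gamma_m$ is output-accessible, i.e. for each of them some vertex of the component reaches the vertex $(\infty,\infty)$ by a directed path in $\Gamma_m$.
   Context: Let $\operatorname{Av}_j(132)$ be the set of permutations of length $j$ with no indices $i<j'<k$ such that $\pi_i<\pi_k<\pi_{j'}$. Fix $m\ge2$, $B_m=\{0,1,\ldots,m-1,\infty\}$, convention $\infty-r=\infty$. Set $c_{1,p}=1$ and, for $2\le k\le m$, $c_{k,p}=|\{\sigma\in\operatorname{Av}_{k-1}(132):k-\sigma_1\le p\}|$ (no condition if $p=\infty$). $W_m(x)$ is the matrix indexed by $B_m^2$ with $W_{(p,q),(r,s)}(x)=\sum_{k=1}^m c_{k,p}x^k\chi_{(r,s)=(m-k,q-k)}+x\chi_{(r,s)=(p-1,m-1)}$, indicators $0$ when the pair has a negative coordinate. $\Gamma_m$ is the directed graph on $B_m^2$ with an edge $(r,s)\to(p,q)$ iff $W_{(p,q),(r,s)}$ is a nonzero polynomial. $U_m=\{(p,\infty):0\le p\le m-1\}$, $V_m=\{(p,q):0\le p,q\le m-1,\ q<p\}\cup\{(p,m-1):0\le p\le m-2\}$, $I_m=\{(\infty,m-1)\}$. -}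

module Defs where

open import Data.Nat as ℕ using (ℕ; zero; suc; _+_; _*_; _∸_; _≤_; _<_; _≤?_; _<?_)
open import Data.Nat.Properties as ℕP using ()
open import Data.Fin as F using (Fin; toℕ; fromℕ<)
open import Data.Fin.Properties as FP using (any?; all?)
open import Data.Vec as Vec using (Vec; []; _∷_; lookup)
open import Data.List as List using (List; []; _∷_; map; concatMap; filter; length; upTo; allFin)
open import Data.Nat.ListAction using (sum)
open import Data.Maybe using (Maybe; just; nothing)
open import Data.Product using (Σ; ∃; ∃-syntax; _×_; _,_)
open import Data.Sum using (_⊎_)
open import Data.Bool using (if_then_else_)
open import Relation.Nullary using (Dec; yes; no; ¬_; does)
open import Relation.Nullary.Decidable using (_×-dec_; _→-dec_; ¬?)
open import Relation.Binary.PropositionalEquality using (_≡_; _≢_; refl; cong)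
open import Relation.Binary.Construct.Closure.ReflexiveTransitive using (Star)

-- A permutation of length n, written in one-line notation with values
-- 0,…,n-1 (i.e. value v stands for v+1), is an injective map Fin n → Fin n,
-- stored as a vector.
IsPerm : ∀ {n} → Vec (Fin n) n → Set
IsPerm {n} σ = (i j : Fin n) → lookup σ i ≡ lookup σ j → i ≡ j

isPerm? : ∀ {n} (σ : Vec (Fin n) n) → Dec (IsPerm σ)
isPerm? σ = all? λ i → all? λ j → (lookup σ i F.≟ lookup σ j) →-dec (i F.≟ j)

Contains132 : ∀ {n} → Vec (Fin n) n → Set
Contains132 {n} σ = ∃[ i ] ∃[ j ] ∃[ k ]
  (i F.< j × j F.< k × lookup σ i F.< lookup σ k × lookup σ k F.< lookup σ j)

contains132? : ∀ {n} (σ : Vec (Fin n) n) → Dec (Contains132 σ)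
contains132? σ = any? λ i → any? λ j → any? λ k →
  (i F.<? j) ×-dec ((j F.<? k) ×-dec
    ((lookup σ i F.<? lookup σ k) ×-dec (lookup σ k F.<? lookup σ j)))

allVecs : ∀ {A : Set} (n : ℕ) → List A → List (Vec A n)
allVecs zero    xs = [] ∷ []
allVecs (suc n) xs = concatMap (λ x → map (x ∷_) (allVecs n xs)) xs

Perms : (n : ℕ) → List (Vec (Fin n) n)
Perms n = filter isPerm? (allVecs n (allFin n))

Av132 : (n : ℕ) → List (Vec (Fin n) n)
Av132 n = filter (λ σ → ¬? (contains132? σ)) (Perms n)

data B (m : ℕ) : Set where
  fin : Fin m → B m
  ∞   : B m

_≟B_ : ∀ {m} (x y : B m) → Dec (x ≡ y)
fin a ≟B fin b with a F.≟ b
... | yes refl = yes refl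
... | no a≢b = no λ { refl → a≢b refl }
fin a ≟B ∞ = no λ ()
∞ ≟B fin b = no λ ()
∞ ≟B ∞ = yes refl

natB : ∀ {m} → ℕ → Maybe (B m)
natB {m} n with n <? m
... | yes n<m = just (fin (fromℕ< n<m))
... | no _ = nothing

-- x - r in B_m ∪ {negative}, with ∞ - r = ∞; nothing = negative
_⊖_ : ∀ {m} → B m → ℕ → Maybe (B m)
∞     ⊖ r = just ∞
fin p ⊖ r with r ≤? toℕ p
... | yes _ = natB (toℕ p ∸ r)
... | no _  = nothing

-- condition k - σ_1 ≤ p  (σ_1 = toℕ (σ 0) + 1); no condition if p = ∞
FirstCond : ∀ {m j} (k : ℕ) (p : B m) → Vec (Fin (suc j)) (suc j) → Set
FirstCond k (fin p) σ = k ∸ suc (toℕ (lookup σ F.zero)) ≤ toℕ p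
FirstCond k ∞       σ = Data.Unit.⊤
  where import Data.Unit

firstCond? : ∀ {m j} (k : ℕ) (p : B m) (σ : Vec (Fin (suc j)) (suc j)) → Dec (FirstCond k p σ)
firstCond? k (fin p) σ = k ∸ suc (toℕ (lookup σ F.zero)) ≤? toℕ p
firstCond? k ∞       σ = yes Data.Unit.tt
  where import Data.Unit

-- c_{k,p} for k ≥ 1 (c 0 p is never used; set to 0)
c : ∀ {m} → ℕ → B m → ℕ
c zero          p = 0
c (suc zero)    p = 1
c (suc (suc j)) p = length (filter (firstCond? (suc (suc j)) p) (Av132 (suc j)))

-- The matrix W_m(x); a polynomial is given by its coefficient sequence.

-- χ_{(r,s) = (a,b)}, where nothing means a negative coordinate (⇒ 0)
χ : ∀ {m} → B m × B m → Maybe (B m) → Maybe (B m) → ℕ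
χ (r , s) (just a) (just b) with r ≟B a | s ≟B b
... | yes _ | yes _ = 1
... | _     | _     = 0
χ _ _ _ = 0

[_≡ᵇ_] : ℕ → ℕ → ℕ
[ a ≡ᵇ b ] = if does (a ℕ.≟ b) then 1 else 0

-- coefficient of x^n in W_{(p,q),(r,s)}(x)
--   = Σ_{k=1}^m c_{k,p} x^k χ_{(r,s)=(m-k,q-k)} + x χ_{(r,s)=(p-1,m-1)}
Wcoeff : (m : ℕ) → B m × B m → B m × B m → ℕ → ℕ
Wcoeff m (p , q) rs n =
  sum (map (λ i → c (suc i) p * [ n ≡ᵇ suc i ] * χ rs (natB (m ∸ suc i)) (q ⊖ suc i)) (upTo m))
  + [ n ≡ᵇ 1 ] * χ rs (p ⊖ 1) (natB (m ∸ 1))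

NonzeroW : (m : ℕ) → B m × B m → B m × B m → Set
NonzeroW m pq rs = ∃[ n ] Wcoeff m pq rs n ≢ 0

Edge : (m : ℕ) → B m × B m → B m × B m → Set
Edge m rs pq = NonzeroW m pq rs

_⊢_⇝_ : (m : ℕ) → B m × B m → B m × B m → Set
m ⊢ u ⇝ v = Star (Edge m) u v

InU : (m : ℕ) → B m × B m → Set
InU m v = ∃[ p ] v ≡ (fin p , ∞)

InV : (m : ℕ) → B m × B m → Set
InV m v = (∃[ p ] ∃[ q ] (v ≡ (fin p , fin q) × toℕ q < toℕ p))
        ⊎ (∃[ p ] ∃[ q ] (v ≡ (fin p , fin q) × toℕ q ≡ m ∸ 1 × toℕ p ≤ m ∸ 2))

InI : (m : ℕ) → B m × B m → Set
InI m v = ∃[ q ] (v ≡ (∞ , fin q) × toℕ q ≡ m ∸ 1)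

OutputAccessible : (m : ℕ) → (B m × B m → Set) → Set
OutputAccessible m S = ∃[ v ] (S v × m ⊢ v ⇝ (∞ , ∞))

{-# OPTIONS --safe #-}
-- The three components reach (∞,∞) along the paths
--   (m-1,∞) → (∞,∞),   (m-2,m-1) → (m-1,∞) → (∞,∞),   (∞,m-1) → (∞,∞),
-- each edge being witnessed by the x-coefficient of W_m: (r,s) → (p,q) holds as soon as
-- (r,s) = (m-1,q-1) (the k = 1 term, as c_{1,p} = 1) or (r,s) = (p-1,m-1) (the last term).

module Submission where

open import Defs
open import Data.Nat using (ℕ; suc; _≤_; _<_; _<?_; _≤?_; _∸_; z≤n; s≤s)
open import Data.Nat.Properties
  using (≤-irrelevant; <-irrelevant; ≤-reflexive; n<1+n; m<n⇒m<1+n; 1+n≢0; m+n≡0⇒m≡0; m+n≡0⇒n≡0)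
open import Data.Nat.ListAction using (sum)
open import Data.List using (map; upTo)
open import Data.Fin using (Fin; toℕ; fromℕ<)
open import Data.Fin.Properties using (toℕ-fromℕ<)
open import Data.Maybe using (Maybe; just)
open import Data.Product using (_×_; _,_)
open import Data.Sum using (inj₂)
open import Function using (_∘_)
open import Relation.Nullary.Decidable using (dec-yes-irr)
open import Relation.Binary.PropositionalEquality using (_≡_; _≢_; refl; sym; trans; cong; subst; ≡-≟-identity)
open import Relation.Binary.Construct.Closure.ReflexiveTransitive using (ε; _◅_)

natB-fromℕ< : ∀ {m n} (n<m : n < m) → natB {m} n ≡ just (fin (fromℕ< n<m))
natB-fromℕ< {m} {n} n<m rewrite dec-yes-irr (n <? m) <-irrelevant n<m = refl

fin⊖ : ∀ {m r} (a : Fin m) → r ≤ toℕ a → fin a ⊖ r ≡ natB (toℕ a ∸ r)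
fin⊖ {r = r} a r≤a rewrite dec-yes-irr (r ≤? toℕ a) ≤-irrelevant r≤a = refl

fin⊖1 : ∀ {m n} (a : Fin m) → toℕ a ≡ suc n → fin a ⊖ 1 ≡ natB n
fin⊖1 a a≡1+n = trans (fin⊖ a (subst (1 ≤_) (sym a≡1+n) (s≤s z≤n))) (cong (λ t → natB (t ∸ 1)) a≡1+n)

χ-refl : ∀ {m} (a b : B m) → χ (a , b) (just a) (just b) ≡ 1
χ-refl a b rewrite ≡-≟-identity _≟B_ {a} refl | ≡-≟-identity _≟B_ {b} refl = refl

χ-just≢0 : ∀ {m} {x y : Maybe (B m)} {r s : B m} → x ≡ just r → y ≡ just s → χ (r , s) x y ≢ 0
χ-just≢0 {r = r} {s} refl refl χ≡0 = 1+n≢0 (trans (sym (χ-refl r s)) χ≡0)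

Wcoeff₁≡0⇒c₁-term≡0 : ∀ {m} p q rs → Wcoeff (suc m) (p , q) rs 1 ≡ 0 → χ rs (natB m) (q ⊖ 1) ≡ 0
Wcoeff₁≡0⇒c₁-term≡0 p q rs W≡0 = m+n≡0⇒m≡0 _ (m+n≡0⇒m≡0 _ (m+n≡0⇒m≡0 _ W≡0))

-- Here the k-sum is stuck on m, so its value has to be supplied to m+n≡0⇒n≡0.
Wcoeff₁≡0⇒shift-term≡0 : ∀ {m} p q rs → Wcoeff m (p , q) rs 1 ≡ 0 → χ rs (p ⊖ 1) (natB (m ∸ 1)) ≡ 0
Wcoeff₁≡0⇒shift-term≡0 {m} p q rs W≡0 = m+n≡0⇒m≡0 _ (m+n≡0⇒n≡0 (sum (map _ (upTo m))) W≡0)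

c₁-edge : ∀ {m r s} p q → natB {suc m} m ≡ just r → q ⊖ 1 ≡ just s → Edge (suc m) (r , s) (p , q)
c₁-edge p q m≡r q-1≡s = 1 , χ-just≢0 m≡r q-1≡s ∘ Wcoeff₁≡0⇒c₁-term≡0 p q _

shift-edge : ∀ {m r s} p q → p ⊖ 1 ≡ just r → natB {m} (m ∸ 1) ≡ just s → Edge m (r , s) (p , q)
shift-edge p q p-1≡r m-1≡s = 1 , χ-just≢0 p-1≡r m-1≡s ∘ Wcoeff₁≡0⇒shift-term≡0 p q _

lemma4p9 : (m : ℕ) → 2 ≤ m →
    OutputAccessible m (InU m) × OutputAccessible m (InV m) × OutputAccessible m (InI m)
lemma4p9 (suc (suc k)) (s≤s (s≤s z≤n)) =
    ((fin last , ∞) , (last , refl) , last∞→∞∞ ◅ ε)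
  , ((fin penult , fin last) , inj₂ (penult , last , refl , toℕ-fromℕ< k+1<m , ≤-reflexive (toℕ-fromℕ< k<m))
    , penult-last→last∞ ◅ last∞→∞∞ ◅ ε)
  , ((∞ , fin last) , (last , refl , toℕ-fromℕ< k+1<m) , ∞last→∞∞ ◅ ε)
  where
  k+1<m : suc k < suc (suc k)
  k+1<m = n<1+n (suc k)
  k<m : k < suc (suc k)
  k<m = m<n⇒m<1+n (n<1+n k)
  last penult : Fin (suc (suc k))
  last = fromℕ< k+1<m
  penult = fromℕ< k<m
  last∞→∞∞ : Edge (suc (suc k)) (fin last , ∞) (∞ , ∞)
  last∞→∞∞ = c₁-edge ∞ ∞ (natB-fromℕ< k+1<m) refl
  ∞last→∞∞ : Edge (suc (suc k)) (∞ , fin last) (∞ , ∞)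
  ∞last→∞∞ = shift-edge ∞ ∞ refl (natB-fromℕ< k+1<m)
  penult-last→last∞ : Edge (suc (suc k)) (fin penult , fin last) (fin last , ∞)
  penult-last→last∞ = shift-edge (fin last) ∞ (trans (fin⊖1 last (toℕ-fromℕ< k+1<m)) (natB-fromℕ< k<m)) (natB-fromℕ< k+1<m)
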